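{- Let $G$ be a graph of order at least $2$ and let $\mathcal{C}$ be an IRC-coloring of $G$. Then for every vertex $v\in V(G)$, there exist two distinct vertices in $N(v)$ that receive the same color in $\mathcal{C}$.
   Context: All graphs are finite, simple, undirected and connected. $N(v)$ is the open neighborhood and $N[v]=N(v)\cup\{v\}$ the closed neighborhood of $v$. Private neighbors. For $S\subseteq V(G)$ and $v\in S$, $pn[v,S]=N[v]\setminus\bigcup_{u\in S\setminus\{v\}}N[u]$. $S$ is irredundant if $pn[v,S]\ne\emptyset$ for all $v\in S$. Rainbow committees and IRC-colorings. For a proper coloring of $G$ with nonempty color classes $V_1,\dots,V_k$, a rainbow committee is a set containing exactly one vertex of each color class. An irredundance compelling coloring (IRC-coloring) is a proper coloring in which every rainbow committee is an irredundant set. -}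

module Defs where

open import Data.Nat using (ℕ; _≥_)
open import Data.Fin using (Fin)
open import Data.Product using (Σ; ∃; ∃-syntax; _×_; _,_)
open import Data.Sum using (_⊎_)
open import Relation.Nullary using (¬_; Dec)
open import Relation.Binary.PropositionalEquality using (_≡_; _≢_)
open import Function using (Surjective)

record Graph (n : ℕ) : Set₁ where
  field
    Adj    : Fin n → Fin n → Set
    adj?   : ∀ u v → Dec (Adj u v)
    sym    : ∀ {u v} → Adj u v → Adj v u
    irrefl : ∀ {u} → ¬ Adj u u

module _ {n : ℕ} (G : Graph n) where
  open Graph G

  data Walk : Fin n → Fin n → Set where
    here : ∀ {u} → Walk u u
    step : ∀ {u w v} → Adj u w → Walk w v → Walk u v

  Connected : Set
  Connected = ∀ u v → Walk u v

  InClosedNbhd : Fin n → Fin n → Set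
  InClosedNbhd w v = w ≡ v ⊎ Adj v w

  record Coloring (k : ℕ) : Set where
    field
      col      : Fin n → Fin k
      proper   : ∀ {u v} → Adj u v → col u ≢ col v
      nonempty : Surjective _≡_ _≡_ col

  RainbowCommittee : ∀ {k} → Coloring k → Set
  RainbowCommittee {k} C = Σ (Fin k → Fin n) λ r → ∀ i → Coloring.col C (r i) ≡ i

  -- the set S = {r i} is irredundant: each member has a private neighbour
  -- pn[r i, S] ≠ ∅ , i.e. some w ∈ N[r i] with w ∉ N[u] for all u ∈ S, u ≠ r i.
  -- (members of S are distinct since they have distinct colours, so
  --  u ≠ r i for u = r j iff j ≠ i)
  IrredundantCommittee : ∀ {k} → (Fin k → Fin n) → Set
  IrredundantCommittee {k} r =
    ∀ i → ∃[ w ] (InClosedNbhd w (r i) × (∀ j → r j ≢ r i → ¬ InClosedNbhd w (r j)))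

  IRCColoring : ∀ {k} → Coloring k → Set
  IRCColoring C = ∀ (R : RainbowCommittee C) → IrredundantCommittee (Σ.proj₁ R)

{-# OPTIONS --safe #-}
module Submission where

-- Fix v and build a rainbow committee that contains v itself and, for every
-- colour occurring in N(v), a neighbour of v of that colour.  The private
-- neighbour w of v cannot be v: v lies in N[u] for the chosen neighbour u.
-- So w is a neighbour of v, and it cannot be the chosen neighbour of its own
-- colour, since w ∈ N[w].  That chosen neighbour and w are the required pair.

open import Defs
open import Data.Nat using (ℕ; _≥_; s≤s; z≤n)
open import Data.Fin using (Fin; zero; punchIn)
open import Data.Fin.Properties using (any?; _≟_; punchInᵢ≢i)
open import Data.Product using (∃-syntax; _×_; _,_; proj₁; proj₂)
open import Data.Sum using (inj₁; inj₂)
open import Relation.Nullary using (Dec; yes; no; ¬_; contradiction)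
open import Relation.Nullary.Decidable using (_×-dec_)
open import Relation.Binary.PropositionalEquality using (_≡_; _≢_; refl; sym; trans; subst)

module _ {n : ℕ} (G : Graph n) where
  open Graph G renaming (sym to Adj-sym)

  Adj⇒≢ : ∀ {u w} → Adj u w → u ≢ w
  Adj⇒≢ a refl = irrefl a

  Walk⇒neighbour : ∀ {u w} → Walk G u w → u ≢ w → ∃[ x ] Adj u x
  Walk⇒neighbour here      u≢u = contradiction refl u≢u
  Walk⇒neighbour (step a _) _  = _ , a

  Connected⇒neighbour : n ≥ 2 → Connected G → ∀ v → ∃[ u ] Adj v u
  Connected⇒neighbour (s≤s (s≤s z≤n)) conn v =
    Walk⇒neighbour (conn v (punchIn v zero)) (λ e → punchInᵢ≢i v zero (sym e))

  module _ {k : ℕ} (C : Coloring G k) where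
    open Coloring C

    TwinNeighbours : Fin n → Set
    TwinNeighbours v = ∃[ u ] ∃[ w ] (u ≢ w × Adj v u × Adj v w × col u ≡ col w)

    module _ (v : Fin n) where

      neighbourOfColour? : ∀ i → Dec (∃[ u ] (Adj v u × col u ≡ i))
      neighbourOfColour? i = any? λ u → adj? v u ×-dec (col u ≟ i)

      chooseOfColour : ∀ i → Dec (i ≡ col v) → Dec (∃[ u ] (Adj v u × col u ≡ i)) → Fin n
      chooseOfColour i (yes _) _              = v
      chooseOfColour i (no _)  (yes (u , _))  = u
      chooseOfColour i (no _)  (no _)         = proj₁ (nonempty i)

      chooseOfColour-col : ∀ i c d → col (chooseOfColour i c d) ≡ i
      chooseOfColour-col i (yes i≡col-v) _            = sym i≡col-v
      chooseOfColour-col i (no _)  (yes (_ , _ , c)) = c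
      chooseOfColour-col i (no _)  (no _)            = proj₂ (nonempty i) refl

      centredCommittee : Fin k → Fin n
      centredCommittee i = chooseOfColour i (i ≟ col v) (neighbourOfColour? i)

      centredCommittee-rainbow : ∀ i → col (centredCommittee i) ≡ i
      centredCommittee-rainbow i = chooseOfColour-col i (i ≟ col v) (neighbourOfColour? i)

      centredCommittee-centre : centredCommittee (col v) ≡ v
      centredCommittee-centre with col v ≟ col v
      ... | yes _ = refl
      ... | no ≢refl = contradiction refl ≢refl

      centredCommittee-Adj : ∀ {u} → Adj v u → Adj v (centredCommittee (col u))
      centredCommittee-Adj {u} a with col u ≟ col v | neighbourOfColour? (col u)
      ... | yes same | _                 = contradiction (sym same) (proper a)
      ... | no _     | yes (_ , a′ , _)  = a′
      ... | no _     | no none           = contradiction (u , a , refl) none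

    irredundant⇒twinNeighbours :
      (r : Fin k → Fin n) → (∀ i → col (r i) ≡ i) → IrredundantCommittee G r →
      ∀ {v} → r (col v) ≡ v → (∀ {u} → Adj v u → Adj v (r (col u))) →
      ∃[ u ] Adj v u → TwinNeighbours v
    irredundant⇒twinNeighbours r rainbow irr {v} centre nbrs (u , v~u)
      with irr (col v)
    ... | w , w∈N[v] , isPrivate = twins w∈N[v]
      where
      notNear : ∀ {x} → Adj v x → ¬ InClosedNbhd G w (r (col x))
      notNear a = isPrivate _ λ e → Adj⇒≢ (nbrs a) (sym (trans e centre))

      twins : InClosedNbhd G w (r (col v)) → TwinNeighbours v
      twins (inj₁ w≡v) =
        contradiction (inj₂ (subst (Adj _) (sym (trans w≡v centre)) (Adj-sym (nbrs v~u))))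
                      (notNear v~u)
      twins (inj₂ centre~w) = twinsAt (subst (λ x → Adj x w) centre centre~w)
        where
        twinsAt : Adj v w → TwinNeighbours v
        twinsAt v~w with r (col w) ≟ w
        ... | yes same  = contradiction (inj₁ (sym same)) (notNear v~w)
        ... | no differ = r (col w) , w , differ , nbrs v~w , v~w , rainbow (col w)

proposition4 : ∀ {n k} (G : Graph n) → n ≥ 2 → Connected G →
    (C : Coloring G k) → IRCColoring G C →
    ∀ (v : Fin n) → ∃[ u ] ∃[ w ] (u ≢ w × Graph.Adj G v u × Graph.Adj G v w
    × Coloring.col C u ≡ Coloring.col C w)
proposition4 {n} {k} G n≥2 conn C irc v =
  irredundant⇒twinNeighbours G C r rainbow (irc (r , rainbow))
    (centredCommittee-centre G C v) (centredCommittee-Adj G C v)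
    (Connected⇒neighbour G n≥2 conn v)
  where
  r : Fin k → Fin n
  r = centredCommittee G C v
  rainbow : ∀ i → Coloring.col C (r i) ≡ i
  rainbow = centredCommittee-rainbow G C v
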